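{- Let $t\ge 1$ be an integer. If there exist infinitely many primes of the form $a^2+1$ with $a\in\mathbb{N}$, then there are infinitely many pairs of distinct $n,n'\in\mathbb{N}$ such that $g_{4t}(n)=g_{4t}(n')$.
   Context: $\mathbb{N}=\{0,1,2,\dots\}$. For an integer $m\ge 2$, an $m$-product sequence is a finite sequence of integers $a_1\le a_2\le\dots\le a_t$ such that $\prod_{i=1}^t a_i=R^m$ for some $R\in\mathbb{N}$ and no integer appears more than $m-1$ times in the sequence. For $n\in\mathbb{N}$, $g_m(n)$ is the least integer $s$ such that there exists an $m$-product sequence $a_1\le\dots\le a_t$ with $a_1=n$ and $a_t=s$. -}

module Defs where

open import Data.Nat using (ℕ; zero; suc; _+_; _*_; _^_; _≤_; _<_; _∸_)
open import Data.Nat.Primality using (Prime)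
open import Data.List using (List; []; _∷_; length; filter; head; last)
open import Data.Nat.ListAction using (product)
open import Data.List.Relation.Unary.All using (All)
open import Data.List.Relation.Unary.Linked using (Linked)
open import Data.Nat.Properties using (_≟_)
open import Data.Maybe using (Maybe; just)
open import Data.Product using (Σ; ∃; _×_)
open import Relation.Binary.PropositionalEquality using (_≡_; _≢_)

-- Sequences are lists of naturals: since a₁ = n ∈ ℕ and the sequence is
-- nondecreasing, all entries are natural numbers.
record IsProductSeq (m : ℕ) (as : List ℕ) : Set where
  field
    sorted   : Linked _≤_ as
    isPower  : ∃ λ (R : ℕ) → product as ≡ R ^ m
    multBound : All (λ a → length (filter (a ≟_) as) ≤ m ∸ 1) as

HasSeq : ℕ → ℕ → ℕ → Set
HasSeq m n s = Σ (List ℕ) λ as →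
  IsProductSeq m as × head as ≡ just n × last as ≡ just s

IsG : ℕ → ℕ → ℕ → Set
IsG m n s = HasSeq m n s × (∀ s′ → HasSeq m n s′ → s ≤ s′)

SameG : ℕ → ℕ → ℕ → Set
SameG m n n′ = ∃ λ s → IsG m n s × IsG m n′ s

InfManyPrimesSqPlusOne : Set
InfManyPrimesSqPlusOne = ∀ N → ∃ λ a → N ≤ a × Prime (a ^ 2 + 1)

module Submission where

-- If P = a² + 1 is prime, put Q = P a² and S = P² = Q + P; then g₄ₜ(Q) = g₄ₜ(S) = S.
-- The upper bounds come from Q^{2t} S^t = (P a)^{4t} and S^{2t} = P^{4t}.
-- For the lower bound on g₄ₜ(Q): if a 4t-product sequence starting at Q ended below Q + P,
-- then Q would be its only term divisible by P, and P ∤ a² = P − 1, so P would divide the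
-- product exactly c times with 1 ≤ c < 4t, which is impossible for a 4t-th power.

open import Defs
open import Data.Nat using (ℕ; _+_; _*_; _≤_)
open import Data.Product using (∃; _×_)
open import Relation.Binary.PropositionalEquality using (_≢_)

open import Level using (Level)
open import Function using (id; _∘_)
open import Data.Empty using (⊥-elim)
open import Data.Sum using ([_,_]′)
open import Data.Product using (_,_; proj₁; proj₂)
open import Data.Nat using (zero; suc; _^_; _<_; _∸_; pred; z≤n; s≤s; NonZero; >-nonZero⁻¹)
open import Data.Nat.Properties
open import Data.Nat.Divisibility
open import Data.Nat.Primality using (Prime; prime⇒nonZero; euclidsLemma; ¬prime[1])
open import Data.Nat.ListAction using (product)
open import Data.Nat.ListAction.Properties using (product-++)
open import Data.Nat.Solver using (module +-*-Solver)
open import Data.List using (List; []; _∷_; length; filter; last; replicate; _++_)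
open import Data.List.Properties using (length-++; filter-++; filter-accept; filter-reject)
open import Data.List.Relation.Unary.All using (All; []; _∷_)
import Data.List.Relation.Unary.All as All
open import Data.List.Relation.Unary.All.Properties using (++⁺; replicate⁺)
open import Data.List.Relation.Unary.Linked using (Linked; []; [-]; _∷_)
import Data.List.Relation.Unary.Linked.Properties as Linked
open import Data.Maybe using (just)
open import Data.Maybe.Relation.Binary.Connected using (Connected; just)
open import Relation.Binary.Core using (Rel)
open import Relation.Binary.Definitions using (Reflexive)
open import Relation.Nullary using (¬_; yes; no)
open import Relation.Binary.PropositionalEquality
  using (_≡_; refl; sym; trans; cong; cong₂; subst; subst₂; module ≡-Reasoning)

private
  variable
    ℓ : Level
    A : Set ℓ
    c d i j k m n p q r s x y : ℕ

count : ℕ → List ℕ → ℕ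
count x xs = length (filter (x ≟_) xs)

count-replicate : ∀ n x → count x (replicate n x) ≡ n
count-replicate zero    x = refl
count-replicate (suc n) x
  rewrite filter-accept (x ≟_) {x} {replicate n x} refl = cong suc (count-replicate n x)

count-replicate-≢ : ∀ n → x ≢ y → count x (replicate n y) ≡ 0
count-replicate-≢ zero    x≢y = refl
count-replicate-≢ {x} {y} (suc n) x≢y
  rewrite filter-reject (x ≟_) {y} {replicate n y} x≢y = count-replicate-≢ n x≢y

count-++ : ∀ x xs ys → count x (xs ++ ys) ≡ count x xs + count x ys
count-++ x xs ys rewrite filter-++ (x ≟_) xs ys = length-++ (filter (x ≟_) xs)

product-replicate : ∀ n x → product (replicate n x) ≡ x ^ n
product-replicate zero    x = refl
product-replicate (suc n) x = cong (x *_) (product-replicate n x)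

Linked-replicate : {R : Rel A ℓ} → Reflexive R → ∀ n (x : A) → Linked R (replicate n x)
Linked-replicate R-refl zero          x = []
Linked-replicate R-refl (suc zero)    x = [-]
Linked-replicate R-refl (suc (suc n)) x = R-refl ∷ Linked-replicate R-refl (suc n) x

last-replicate : ∀ n (x : A) → last (replicate (suc n) x) ≡ just x
last-replicate zero    x = refl
last-replicate (suc n) x = last-replicate n x

last-++ : ∀ (xs : List A) y ys → last (xs ++ y ∷ ys) ≡ last (y ∷ ys)
last-++ []           y ys = refl
last-++ (x ∷ [])     y ys = refl
last-++ (x ∷ x′ ∷ xs) y ys = last-++ (x′ ∷ xs) y ys

Linked⇒All-≤-last : ∀ {xs} → Linked _≤_ xs → last xs ≡ just s → All (_≤ s) xs
Linked⇒All-≤-last []              _      = []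
Linked⇒All-≤-last [-]             refl   = ≤-refl ∷ []
Linked⇒All-≤-last (x≤y ∷ rest-sorted) last≡ with Linked⇒All-≤-last rest-sorted last≡
... | y≤s ∷ rest≤s = ≤-trans x≤y y≤s ∷ y≤s ∷ rest≤s

n≤n^2 : ∀ n → n ≤ n ^ 2
n≤n^2 zero    = z≤n
n≤n^2 (suc n) = m≤m*n (suc n) (suc n * 1)

^-distrib-* : ∀ m n o → (m * n) ^ o ≡ m ^ o * n ^ o
^-distrib-* m n zero    = refl
^-distrib-* m n (suc o) = trans (cong (m * n *_) (^-distrib-* m n o)) ([m*n]*[o*p]≡[m*o]*[n*p] m n (m ^ o) (n ^ o))

^-monoˡ-∣ : ∀ o → m ∣ n → m ^ o ∣ n ^ o
^-monoˡ-∣ zero    m∣n = ∣-refl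
^-monoˡ-∣ (suc o) m∣n = *-pres-∣ m∣n (^-monoˡ-∣ o m∣n)

^-monoʳ-∣ : ∀ p → m ≤ n → p ^ m ∣ p ^ n
^-monoʳ-∣ {m} {n} p m≤n = subst (p ^ m ∣_) p^m*p^[n∸m]≡p^n (m∣m*n (p ^ (n ∸ m)))
  where
  p^m*p^[n∸m]≡p^n : p ^ m * p ^ (n ∸ m) ≡ p ^ n
  p^m*p^[n∸m]≡p^n = trans (sym (^-distribˡ-+-* p m (n ∸ m))) (cong (p ^_) (m+[n∸m]≡n m≤n))

prime∤1 : Prime p → ¬ p ∣ 1
prime∤1 pr p∣1 = ¬prime[1] (subst Prime (∣1⇒≡1 p∣1) pr)

prime∤pred : Prime p → ¬ p ∣ pred p
prime∤pred {suc zero}    pr = ⊥-elim (¬prime[1] pr)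
prime∤pred {suc (suc n)} pr = >⇒∤ ≤-refl

prime∣^⇒∣ : Prime p → p ∣ m ^ n → p ∣ m
prime∣^⇒∣ {n = zero}          pr p∣1     = ⊥-elim (prime∤1 pr p∣1)
prime∣^⇒∣ {p} {m} {n = suc n} pr p∣m^1+n =
  [ id , prime∣^⇒∣ {n = n} pr ]′ (euclidsLemma m (m ^ n) pr p∣m^1+n)

multiple-in-window⇒≡ : p ∣ q → p ∣ y → q ≤ y → y < q + p → y ≡ q
multiple-in-window⇒≡ {p} {q} {y} p∣q p∣y q≤y y<q+p with y ∸ q | m+[n∸m]≡n q≤y
... | zero  | q+0≡y = trans (sym q+0≡y) (+-identityʳ q)
... | suc r | q+r≡y = ⊥-elim (>⇒∤ r<p p∣r)
  where
  p∣r : p ∣ suc r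
  p∣r = ∣m+n∣m⇒∣n (subst (p ∣_) (sym q+r≡y) p∣y) p∣q
  r<p : suc r < p
  r<p = +-cancelˡ-< q (suc r) p (subst (_< q + p) (sym q+r≡y) y<q+p)

record Multiplicity (p n c : ℕ) : Set where
  constructor multiplicity
  field
    cofactor    : ℕ
    factorised  : n ≡ p ^ c * cofactor
    p∤cofactor  : ¬ p ∣ cofactor

multiplicity-0 : ¬ p ∣ n → Multiplicity p n 0
multiplicity-0 {n = n} p∤n = multiplicity n (sym (*-identityˡ n)) p∤n

multiplicity-1 : ¬ p ∣ k → Multiplicity p (p * k) 1
multiplicity-1 {p} {k} p∤k = multiplicity k (cong (_* k) (sym (*-identityʳ p))) p∤k

multiplicity-* : Prime p → Multiplicity p m c → Multiplicity p n d → Multiplicity p (m * n) (c + d)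
multiplicity-* {p} {c = c} {d = d} pr (multiplicity m′ refl p∤m′) (multiplicity n′ refl p∤n′) =
  multiplicity (m′ * n′)
    (trans ([m*n]*[o*p]≡[m*o]*[n*p] (p ^ c) m′ (p ^ d) n′) (cong (_* (m′ * n′)) (sym (^-distribˡ-+-* p c d))))
    ([ p∤m′ , p∤n′ ]′ ∘ euclidsLemma m′ n′ pr)

multiplicity-product : Prime p → Multiplicity p q 1 → ∀ {xs} → All (λ y → y ≢ q → ¬ p ∣ y) xs →
                       Multiplicity p (product xs) (count q xs)
multiplicity-product pr _ [] = multiplicity-0 (prime∤1 pr)
multiplicity-product {q = q} pr v[q] {y ∷ ys} (y≢q⇒p∤y ∷ rest) with y ≟ q
... | yes refl rewrite filter-accept (y ≟_) {y} {ys} refl =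
  multiplicity-* pr v[q] (multiplicity-product pr v[q] rest)
... | no y≢q rewrite filter-reject (q ≟_) {y} {ys} (y≢q ∘ sym) =
  multiplicity-* pr (multiplicity-0 (y≢q⇒p∤y y≢q)) (multiplicity-product pr v[q] rest)

-- p ∣ r gives p ^ m ∣ r ^ m = p ^ c * m′, which for c < m would put p ^ (1 + c) into p ^ c * m′.
multiplicity-^-≥ : Prime p → Multiplicity p (r ^ m) c → 0 < c → m ≤ c
multiplicity-^-≥ {p} {r} {m} {c@(suc c′)} pr (multiplicity m′ r^m≡ p∤m′) _ with m ≤? c
... | yes m≤c = m≤c
... | no  m≰c = ⊥-elim (p∤m′ (*-cancelˡ-∣ (p ^ c) {{m^n≢0 p c}} p^c*p∣p^c*m′))
  where
  instance
    p≢0 : NonZero p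
    p≢0 = prime⇒nonZero pr
  p∣r : p ∣ r
  p∣r = prime∣^⇒∣ {n = m} pr (subst (p ∣_) (sym r^m≡) (∣m⇒∣m*n m′ (m∣m*n (p ^ c′))))
  p^c*p∣p^c*m′ : p ^ c * p ∣ p ^ c * m′
  p^c*p∣p^c*m′ = subst₂ _∣_ (*-comm p (p ^ c)) r^m≡ (∣-trans (^-monoʳ-∣ p (≰⇒> m≰c)) (^-monoˡ-∣ m p∣r))

0<m≤pred[n]⇒m<n : 0 < m → m ≤ pred n → m < n
0<m≤pred[n]⇒m<n {n = zero}  0<m m≤0 = ⊥-elim (<⇒≱ 0<m m≤0)
0<m≤pred[n]⇒m<n {n = suc n} _   m≤n = s≤s m≤n

HasSeq-head≤last : HasSeq m n s → n ≤ s
HasSeq-head≤last (_ ∷ _ , ps , refl , last≡) =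
  All.head (Linked⇒All-≤-last (IsProductSeq.sorted ps) last≡)

replicate-HasSeq : ∀ {R} → 0 < i → i < m → y ^ i ≡ R ^ m → HasSeq m y y
replicate-HasSeq {suc i} {m} {y} {R} _ i<m y^i≡R^m =
  replicate (suc i) y ,
  record
    { sorted    = Linked-replicate ≤-refl (suc i) y
    ; isPower   = R , trans (product-replicate (suc i) y) y^i≡R^m
    ; multBound = replicate⁺ (suc i) (subst (_≤ pred m) (sym (count-replicate (suc i) y)) (<⇒≤pred i<m))
    } ,
  refl , last-replicate i y

replicate₂-HasSeq : ∀ {R} → x < y → 0 < i → i < m → 0 < j → j < m → x ^ i * y ^ j ≡ R ^ m → HasSeq m x y
replicate₂-HasSeq {x} {y} {suc i} {m} {suc j} {R} x<y _ i<m _ j<m x^i*y^j≡R^m =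
  xs ,
  record
    { sorted    = Linked.++⁺ (Linked-replicate ≤-refl (suc i) x) x≤y (Linked-replicate ≤-refl (suc j) y)
    ; isPower   = R , product≡
    ; multBound = ++⁺ (replicate⁺ (suc i) (subst (_≤ pred m) (sym count-x) (<⇒≤pred i<m)))
                      (replicate⁺ (suc j) (subst (_≤ pred m) (sym count-y) (<⇒≤pred j<m)))
    } ,
  refl , trans (last-++ (replicate (suc i) x) y (replicate j y)) (last-replicate j y)
  where
  open ≡-Reasoning
  xs : List ℕ
  xs = replicate (suc i) x ++ replicate (suc j) y
  x≤y : Connected _≤_ (last (replicate (suc i) x)) (just y)
  x≤y = subst (λ l → Connected _≤_ l (just y)) (sym (last-replicate i x)) (just (<⇒≤ x<y))
  product≡ : product xs ≡ R ^ m
  product≡ = begin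
    product xs                                                 ≡⟨ product-++ (replicate (suc i) x) _ ⟩
    product (replicate (suc i) x) * product (replicate (suc j) y) ≡⟨ cong₂ _*_ (product-replicate (suc i) x) (product-replicate (suc j) y) ⟩
    x ^ suc i * y ^ suc j                                      ≡⟨ x^i*y^j≡R^m ⟩
    R ^ m                                                      ∎
  count-x : count x xs ≡ suc i
  count-x = begin
    count x xs                                                 ≡⟨ count-++ x (replicate (suc i) x) _ ⟩
    count x (replicate (suc i) x) + count x (replicate (suc j) y) ≡⟨ cong₂ _+_ (count-replicate (suc i) x) (count-replicate-≢ (suc j) (<⇒≢ x<y)) ⟩
    suc i + 0                                                  ≡⟨ +-identityʳ (suc i) ⟩
    suc i                                                      ∎
  count-y : count y xs ≡ suc j
  count-y = begin
    count y xs                                                 ≡⟨ count-++ y (replicate (suc i) x) _ ⟩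
    count y (replicate (suc i) x) + count y (replicate (suc j) y) ≡⟨ cong₂ _+_ (count-replicate-≢ (suc i) (>⇒≢ x<y)) (count-replicate (suc j) y) ⟩
    suc j                                                      ∎

head+prime≤last : Prime p → ¬ p ∣ k → HasSeq m (p * k) s → p * k + p ≤ s
head+prime≤last {p} {k} {m} {s} pr p∤k (_ ∷ xs , ps , refl , last≡) with p * k + p ≤? s
... | yes pk+p≤s = pk+p≤s
... | no  pk+p≰s = ⊥-elim (<⇒≱ c<m (multiplicity-^-≥ pr v[product] 0<c))
  where
  open IsProductSeq ps
  in-window : All (λ y → p * k ≤ y × y < p * k + p) (p * k ∷ xs)
  in-window = All.zip ( Linked.Linked⇒All ≤-trans ≤-refl sorted
                      , All.map (λ y≤s → ≤-<-trans y≤s (≰⇒> pk+p≰s)) (Linked⇒All-≤-last sorted last≡))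
  p∤others : All (λ y → y ≢ p * k → ¬ p ∣ y) (p * k ∷ xs)
  p∤others = All.map (λ (pk≤y , y<pk+p) y≢pk p∣y → y≢pk (multiple-in-window⇒≡ (m∣m*n k) p∣y pk≤y y<pk+p)) in-window
  v[product] : Multiplicity p (proj₁ isPower ^ m) (count (p * k) (p * k ∷ xs))
  v[product] = subst (λ n → Multiplicity p n _) (proj₂ isPower) (multiplicity-product pr (multiplicity-1 p∤k) p∤others)
  0<c : 0 < count (p * k) (p * k ∷ xs)
  0<c rewrite filter-accept ((p * k) ≟_) {p * k} {xs} refl = s≤s z≤n
  c<m : count (p * k) (p * k ∷ xs) < m
  c<m = 0<m≤pred[n]⇒m<n 0<c (All.head multBound)

module SquarePlusOnePrime (a : ℕ) (pr : Prime (a ^ 2 + 1)) where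
  open +-*-Solver

  P Q S : ℕ
  P = a ^ 2 + 1
  Q = P * a ^ 2
  S = P * P

  instance
    P≢0 : NonZero P
    P≢0 = prime⇒nonZero pr

  P∤a^2 : ¬ P ∣ a ^ 2
  P∤a^2 = subst (λ n → ¬ P ∣ n) (m+n∸n≡m (a ^ 2) 1) (prime∤pred pr)

  S≡Q+P : S ≡ Q + P
  S≡Q+P = trans (*-distribˡ-+ P (a ^ 2) 1) (cong (Q +_) (*-identityʳ P))

  Q<S : Q < S
  Q<S = subst (Q <_) (sym S≡Q+P) (m<m+n Q (>-nonZero⁻¹ P))

  a≤Q+S : a ≤ Q + S
  a≤Q+S = ≤-trans (n≤n^2 a) (≤-trans (m≤n*m (a ^ 2) P) (m≤m+n Q S))

  module _ (t : ℕ) .{{_ : NonZero t}} where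
    0<t : 0 < t
    0<t = >-nonZero⁻¹ t

    t<4t : t < 4 * t
    t<4t = m<m+n t (*-monoʳ-< 3 0<t)

    2t<4t : 2 * t < 4 * t
    2t<4t = *-monoˡ-< t {2} {4} (s≤s (s≤s (s≤s z≤n)))

    Q^2t*S^t≡[Pa]^4t : Q ^ (2 * t) * S ^ t ≡ (P * a) ^ (4 * t)
    Q^2t*S^t≡[Pa]^4t = begin
      Q ^ (2 * t) * S ^ t  ≡⟨ cong (_* S ^ t) (sym (^-*-assoc Q 2 t)) ⟩
      (Q ^ 2) ^ t * S ^ t  ≡⟨ sym (^-distrib-* (Q ^ 2) S t) ⟩
      (Q ^ 2 * S) ^ t      ≡⟨ cong (_^ t) (solve 2 (λ p a → (p :* a :^ 2) :^ 2 :* (p :* p) := (p :* a) :^ 4) refl P a) ⟩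
      ((P * a) ^ 4) ^ t    ≡⟨ ^-*-assoc (P * a) 4 t ⟩
      (P * a) ^ (4 * t)    ∎
      where open ≡-Reasoning

    S^2t≡P^4t : S ^ (2 * t) ≡ P ^ (4 * t)
    S^2t≡P^4t = begin
      S ^ (2 * t)    ≡⟨ sym (^-*-assoc S 2 t) ⟩
      (S ^ 2) ^ t    ≡⟨ cong (_^ t) (solve 1 (λ p → (p :* p) :^ 2 := p :^ 4) refl P) ⟩
      (P ^ 4) ^ t    ≡⟨ ^-*-assoc P 4 t ⟩
      P ^ (4 * t)    ∎
      where open ≡-Reasoning

    g[Q]≡S : IsG (4 * t) Q S
    g[Q]≡S = replicate₂-HasSeq Q<S (*-monoʳ-< 2 0<t) 2t<4t 0<t t<4t Q^2t*S^t≡[Pa]^4t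
           , λ s′ → subst (_≤ s′) (sym S≡Q+P) ∘ head+prime≤last pr P∤a^2

    g[S]≡S : IsG (4 * t) S S
    g[S]≡S = replicate-HasSeq (*-monoʳ-< 2 0<t) 2t<4t S^2t≡P^4t , λ _ → HasSeq-head≤last

proposition5p12 : (t : ℕ) → 1 ≤ t → InfManyPrimesSqPlusOne →
    ∀ N → ∃ λ n → ∃ λ n′ → n ≢ n′ × N ≤ n + n′ × SameG (4 * t) n n′
proposition5p12 (suc t) (s≤s z≤n) infinitelyMany N with infinitelyMany N
... | a , N≤a , pr = Q , S , <⇒≢ Q<S , ≤-trans N≤a a≤Q+S , S , g[Q]≡S (suc t) , g[S]≡S (suc t)
  where open SquarePlusOnePrime a pr
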